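{- Let $r(a,b)$ be an integer-valued function defined for $1\le a\le b\le n$ satisfying (i) $r(a,a)\ge0$; (ii) $\max\{r(a,b-1),r(a+1,b)\}\le r(a,b)$ for $a<b$; (iii) $r(a,b)\le r(a,b-1)+r(a+1,b)-r(a+1,b-1)$ for $a<b$, with $r(a+1,b-1):=0$ when $a+1>b-1$. Define $\rho:2^N\to\mathbb{Z}$ ($N=\{1,\dots,n\}$) by $\rho(\emptyset)=0$ and, for nonempty $X=I(a_1,b_1)\cup\cdots\cup I(a_m,b_m)$ written as the disjoint union of its maximal consecutive blocks ($a_1\le b_1$, $b_j+1<a_{j+1}\le b_{j+1}$), $\rho(X)=\sum_{j=1}^m r(a_j,b_j)$. Then $\rho$ is submodular: $\rho(X)+\rho(Y)\ge\rho(X\cup Y)+\rho(X\cap Y)$ for all $X,Y\subseteq N$.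
   Context: $I(a,b)=\{i\in\mathbb{Z}: a\le i\le b\}$. -}

module Defs where

open import Data.Nat using (ℕ; zero; suc; _∸_; _≤ᵇ_)
open import Data.Integer using (ℤ; 0ℤ; _+_)
open import Data.Bool using (Bool; true; false; if_then_else_)
open import Data.Maybe using (Maybe; just; nothing)
open import Data.Product using (_×_; _,_)
open import Data.List using (List; []; _∷_; map; foldr)
open import Data.Vec using (Vec; []; _∷_)
open import Data.Fin.Subset using (Subset)

-- Convention: a subset X : Subset n of N = {1,…,n}; the i-th entry of the
-- vector (0-based) records whether the element i+1 belongs to X.

-- Scan the vector, tracking the current (1-based) position p and the start s
-- of the currently open maximal block of consecutive elements (if any).
blocksAux : {k : ℕ} → ℕ → Maybe ℕ → Vec Bool k → List (ℕ × ℕ)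
blocksAux p nothing  []            = []
blocksAux p (just s) []            = (s , p ∸ 1) ∷ []
blocksAux p nothing  (true  ∷ xs)  = blocksAux (suc p) (just p) xs
blocksAux p nothing  (false ∷ xs)  = blocksAux (suc p) nothing xs
blocksAux p (just s) (true  ∷ xs)  = blocksAux (suc p) (just s) xs
blocksAux p (just s) (false ∷ xs)  = (s , p ∸ 1) ∷ blocksAux (suc p) nothing xs

blocks : {n : ℕ} → Subset n → List (ℕ × ℕ)
blocks X = blocksAux 1 nothing X

sumℤ : List ℤ → ℤ
sumℤ = foldr _+_ 0ℤ

ρ : {n : ℕ} → (ℕ → ℕ → ℤ) → Subset n → ℤ
ρ r X = sumℤ (map (λ { (a , b) → r a b }) (blocks X))

rInner : (ℕ → ℕ → ℤ) → ℕ → ℕ → ℤ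
rInner r a b = if suc a ≤ᵇ (b ∸ 1) then r (suc a) (b ∸ 1) else 0ℤ

-- Listing a block I(a,b) as a, a+1, …, b, its value r(a,b) telescopes into the
-- gains g(a,p) = r(a,p) − r(a,p−1) (with r(a,a−1) = 0), so ρ(X) = Σ_{p∈X} g(s_X p, p)
-- where s_X p is the start of the block of X containing p.  Condition (iii) says
-- precisely that g(a,p) is nondecreasing in a.  For p ∈ X ∪ Y the block of X ∪ Y
-- starts no later than those of X and Y, and for p ∈ X ∩ Y the block of X ∩ Y
-- starts at the later of the two.
module Submission where

open import Defs
open import Data.Nat using (ℕ; zero; suc; _∸_; _≤ᵇ_; _<ᵇ_; z≤n; s≤s; _≤′_; ≤′-refl; ≤′-step) renaming (_≤_ to _≤ℕ_; _<_ to _<ℕ_; _+_ to _+ℕ_)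
open import Data.Integer using (ℤ; 0ℤ; _+_; _-_; -_; _≤_; _⊔_)
open import Data.Fin.Subset using (Subset; _∪_; _∩_)

import Data.Nat.Properties as ℕ
import Data.Integer.Properties as ℤ
open import Data.Integer.Tactic.RingSolver using (solve-∀)
open import Algebra.Properties.CommutativeSemigroup ℤ.+-commutativeSemigroup using (interchange)
open import Data.Bool using (Bool; true; false; if_then_else_; _∨_; _∧_)
open import Data.Bool.Properties using (T-≡)
open import Data.Maybe using (just; nothing)
open import Data.Product using (_×_; _,_)
open import Data.Sum using (_⊎_; inj₁; inj₂)
open import Data.List using (map)
open import Data.Vec using (Vec; []; _∷_)
open import Function.Bundles using (Equivalence)
open import Relation.Binary.PropositionalEquality

+-interchange-mono : ∀ {a b c d a′ b′ c′ d′} → a + b ≤ c + d → a′ + b′ ≤ c′ + d′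
  → (a + a′) + (b + b′) ≤ (c + c′) + (d + d′)
+-interchange-mono {a} {b} {c} {d} {a′} {b′} {c′} {d′} ab≤cd ab′≤cd′ = begin
  (a + a′) + (b + b′) ≡⟨ interchange a a′ b b′ ⟩
  (a + b) + (a′ + b′) ≤⟨ ℤ.+-mono-≤ ab≤cd ab′≤cd′ ⟩
  (c + d) + (c′ + d′) ≡⟨ interchange c d c′ d′ ⟩
  (c + c′) + (d + d′) ∎
  where open ℤ.≤-Reasoning

<ᵇ-irrefl : ∀ m → (m <ᵇ m) ≡ false
<ᵇ-irrefl zero = refl
<ᵇ-irrefl (suc m) = <ᵇ-irrefl m

nextStart : Bool → ℕ → ℕ → ℕ
nextStart b s p = if b then s else suc p

module _ (g : ℕ → ℕ → ℤ) where

  gainAt : Bool → ℕ → ℕ → ℤ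
  gainAt b s p = if b then g s p else 0ℤ

  -- s is the start of the block that p joins if it lies in the set.
  gainSum : {k : ℕ} → ℕ → ℕ → Vec Bool k → ℤ
  gainSum p s [] = 0ℤ
  gainSum p s (b ∷ xs) = gainAt b s p + gainSum (suc p) (nextStart b s p) xs

-- Starts of the current blocks of X ∪ Y, X ∩ Y, X and Y at position p; the start of
-- X ∩ Y is in fact max sX sY, but only the disjunction below is needed.
record StartsCompatible (p sU sI sX sY : ℕ) : Set where
  field
    1≤sU : 1 ≤ℕ sU
    1≤sI : 1 ≤ℕ sI
    sX≤p : sX ≤ℕ p
    sY≤p : sY ≤ℕ p
    sU≤sX : sU ≤ℕ sX
    sU≤sY : sU ≤ℕ sY
    sI≤sX⊎sI≤sY : sI ≤ℕ sX ⊎ sI ≤ℕ sY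

open StartsCompatible

startsCompatible-next : ∀ {p sU sI sX sY} → StartsCompatible p sU sI sX sY → (bx by : Bool)
  → StartsCompatible (suc p) (nextStart (bx ∨ by) sU p) (nextStart (bx ∧ by) sI p)
                             (nextStart bx sX p) (nextStart by sY p)
startsCompatible-next c false false =
  record { 1≤sU = s≤s z≤n ; 1≤sI = s≤s z≤n ; sX≤p = ℕ.≤-refl ; sY≤p = ℕ.≤-refl
         ; sU≤sX = ℕ.≤-refl ; sU≤sY = ℕ.≤-refl ; sI≤sX⊎sI≤sY = inj₁ ℕ.≤-refl }
startsCompatible-next c true false =
  record { 1≤sU = 1≤sU c ; 1≤sI = s≤s z≤n ; sX≤p = ℕ.m≤n⇒m≤1+n (sX≤p c) ; sY≤p = ℕ.≤-refl
         ; sU≤sX = sU≤sX c ; sU≤sY = ℕ.m≤n⇒m≤1+n (ℕ.≤-trans (sU≤sX c) (sX≤p c)) ; sI≤sX⊎sI≤sY = inj₂ ℕ.≤-refl }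
startsCompatible-next c false true =
  record { 1≤sU = 1≤sU c ; 1≤sI = s≤s z≤n ; sX≤p = ℕ.≤-refl ; sY≤p = ℕ.m≤n⇒m≤1+n (sY≤p c)
         ; sU≤sX = ℕ.m≤n⇒m≤1+n (ℕ.≤-trans (sU≤sY c) (sY≤p c)) ; sU≤sY = sU≤sY c ; sI≤sX⊎sI≤sY = inj₁ ℕ.≤-refl }
startsCompatible-next c true true =
  record { 1≤sU = 1≤sU c ; 1≤sI = 1≤sI c ; sX≤p = ℕ.m≤n⇒m≤1+n (sX≤p c) ; sY≤p = ℕ.m≤n⇒m≤1+n (sY≤p c)
         ; sU≤sX = sU≤sX c ; sU≤sY = sU≤sY c ; sI≤sX⊎sI≤sY = sI≤sX⊎sI≤sY c }

module _ (g : ℕ → ℕ → ℤ) (n : ℕ)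
         (g-mono : ∀ {a b p} → 1 ≤ℕ a → a ≤ℕ b → b ≤ℕ p → p ≤ℕ n → g a p ≤ g b p) where

  gainAt-submodular : ∀ {p sU sI sX sY} → p ≤ℕ n → StartsCompatible p sU sI sX sY → (bx by : Bool)
    → gainAt g (bx ∨ by) sU p + gainAt g (bx ∧ by) sI p ≤ gainAt g bx sX p + gainAt g by sY p
  gainAt-submodular p≤n c false false = ℤ.≤-refl
  gainAt-submodular p≤n c true false = ℤ.+-monoˡ-≤ 0ℤ (g-mono (1≤sU c) (sU≤sX c) (sX≤p c) p≤n)
  gainAt-submodular {p} {sU} {sI} {sX} {sY} p≤n c false true = begin
    g sU p + 0ℤ ≡⟨ ℤ.+-identityʳ (g sU p) ⟩
    g sU p      ≤⟨ g-mono (1≤sU c) (sU≤sY c) (sY≤p c) p≤n ⟩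
    g sY p      ≡⟨ ℤ.+-identityˡ (g sY p) ⟨
    0ℤ + g sY p ∎
    where open ℤ.≤-Reasoning
  gainAt-submodular {p} {sU} {sI} {sX} {sY} p≤n c true true with sI≤sX⊎sI≤sY c
  ... | inj₁ sI≤sX = begin
    g sU p + g sI p ≤⟨ ℤ.+-mono-≤ (g-mono (1≤sU c) (sU≤sY c) (sY≤p c) p≤n) (g-mono (1≤sI c) sI≤sX (sX≤p c) p≤n) ⟩
    g sY p + g sX p ≡⟨ ℤ.+-comm (g sY p) (g sX p) ⟩
    g sX p + g sY p ∎
    where open ℤ.≤-Reasoning
  ... | inj₂ sI≤sY = ℤ.+-mono-≤ (g-mono (1≤sU c) (sU≤sX c) (sX≤p c) p≤n) (g-mono (1≤sI c) sI≤sY (sY≤p c) p≤n)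

  gainSum-submodular : ∀ {k} p {sU sI sX sY} → k +ℕ p ≤ℕ suc n → StartsCompatible p sU sI sX sY
    → (xs ys : Vec Bool k)
    → gainSum g p sU (xs ∪ ys) + gainSum g p sI (xs ∩ ys) ≤ gainSum g p sX xs + gainSum g p sY ys
  gainSum-submodular p bound c [] [] = ℤ.≤-refl
  -- ℤ's _+_ computes by matching, so Agda cannot invert it: the summands are given explicitly.
  gainSum-submodular {suc k} p {sU} {sI} {sX} {sY} bound c (bx ∷ xs) (by ∷ ys) =
    +-interchange-mono {gainAt g (bx ∨ by) sU p} {gainAt g (bx ∧ by) sI p} {gainAt g bx sX p} {gainAt g by sY p}
      (gainAt-submodular p≤n c bx by)
      (gainSum-submodular (suc p) bound′ (startsCompatible-next c bx by) xs ys)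
    where
    p≤n : p ≤ℕ n
    p≤n = ℕ.≤-trans (ℕ.m≤n+m p k) (ℕ.≤-pred bound)
    bound′ : k +ℕ suc p ≤ℕ suc n
    bound′ = ℕ.≤-trans (ℕ.≤-reflexive (ℕ.+-suc k p)) bound

module _ (r : ℕ → ℕ → ℤ) where

  -- The test a ≤ᵇ p ∸ 1 mirrors rInner, so that gain r (suc a) b is definitionally
  -- r (suc a) b - rInner r a b.
  gain : ℕ → ℕ → ℤ
  gain a p = r a p - (if a ≤ᵇ p ∸ 1 then r a (p ∸ 1) else 0ℤ)

  gain-diag : ∀ p → 1 ≤ℕ p → gain p p ≡ r p p
  gain-diag (suc q) _ rewrite <ᵇ-irrefl q = ℤ.+-identityʳ (r (suc q) (suc q))

  gain-< : ∀ {a p} → a <ℕ p → gain a p ≡ r a p - r a (p ∸ 1)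
  gain-< {a} {suc q} (s≤s a≤q) rewrite Equivalence.to T-≡ (ℕ.≤⇒≤ᵇ a≤q) = refl

  -- The pattern-matching lambda inside ρ cannot be named, so the sum over blocks is
  -- stated for any f agreeing with r.
  module _ (f : ℕ × ℕ → ℤ) (f≗r : ∀ a b → f (a , b) ≡ r a b) where

    sumBlocks-closed : ∀ {k} p → 1 ≤ℕ p → (xs : Vec Bool k)
      → sumℤ (map f (blocksAux p nothing xs)) ≡ gainSum gain p p xs
    sumBlocks-open : ∀ {k} p s → s <ℕ p → (xs : Vec Bool k)
      → sumℤ (map f (blocksAux p (just s) xs)) ≡ gainSum gain p s xs + r s (p ∸ 1)

    sumBlocks-closed p 1≤p [] = refl
    sumBlocks-closed p 1≤p (true ∷ xs) = begin
      sumℤ (map f (blocksAux (suc p) (just p) xs)) ≡⟨ sumBlocks-open (suc p) p ℕ.≤-refl xs ⟩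
      gainSum gain (suc p) p xs + r p p           ≡⟨ ℤ.+-comm _ (r p p) ⟩
      r p p + gainSum gain (suc p) p xs           ≡⟨ cong (_+ gainSum gain (suc p) p xs) (gain-diag p 1≤p) ⟨
      gain p p + gainSum gain (suc p) p xs        ∎
      where open ≡-Reasoning
    sumBlocks-closed p 1≤p (false ∷ xs) =
      trans (sumBlocks-closed (suc p) (s≤s z≤n) xs) (sym (ℤ.+-identityˡ _))

    sumBlocks-open p s s<p [] = begin
      f (s , p ∸ 1) + 0ℤ ≡⟨ ℤ.+-identityʳ _ ⟩
      f (s , p ∸ 1)      ≡⟨ f≗r s (p ∸ 1) ⟩
      r s (p ∸ 1)        ≡⟨ ℤ.+-identityˡ _ ⟨
      0ℤ + r s (p ∸ 1)   ∎
      where open ≡-Reasoning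
    sumBlocks-open p s s<p (true ∷ xs) = begin
      sumℤ (map f (blocksAux (suc p) (just s) xs)) ≡⟨ sumBlocks-open (suc p) s (ℕ.m≤n⇒m≤1+n s<p) xs ⟩
      gainSum gain (suc p) s xs + r s p            ≡⟨ telescope (gainSum gain (suc p) s xs) (r s p) (r s (p ∸ 1)) ⟩
      ((r s p - r s (p ∸ 1)) + gainSum gain (suc p) s xs) + r s (p ∸ 1)
        ≡⟨ cong (λ d → (d + gainSum gain (suc p) s xs) + r s (p ∸ 1)) (gain-< s<p) ⟨
      (gain s p + gainSum gain (suc p) s xs) + r s (p ∸ 1) ∎
      where
      open ≡-Reasoning
      telescope : ∀ h x y → h + x ≡ ((x - y) + h) + y
      telescope = solve-∀
    sumBlocks-open p s s<p (false ∷ xs) = begin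
      f (s , p ∸ 1) + sumℤ (map f (blocksAux (suc p) nothing xs))
        ≡⟨ cong₂ _+_ (f≗r s (p ∸ 1)) (sumBlocks-closed (suc p) (s≤s z≤n) xs) ⟩
      r s (p ∸ 1) + gainSum gain (suc p) (suc p) xs        ≡⟨ ℤ.+-comm (r s (p ∸ 1)) _ ⟩
      gainSum gain (suc p) (suc p) xs + r s (p ∸ 1)
        ≡⟨ cong (_+ r s (p ∸ 1)) (ℤ.+-identityˡ (gainSum gain (suc p) (suc p) xs)) ⟨
      (0ℤ + gainSum gain (suc p) (suc p) xs) + r s (p ∸ 1) ∎
      where open ≡-Reasoning

  ρ≡gainSum : ∀ {n} (X : Subset n) → ρ r X ≡ gainSum gain 1 1 X
  ρ≡gainSum X = sumBlocks-closed _ (λ _ _ → refl) 1 ℕ.≤-refl X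

  module _ (n : ℕ)
    (r-submodular : ∀ a b → 1 ≤ℕ a → a <ℕ b → b ≤ℕ n → r a b ≤ r a (b ∸ 1) + r (suc a) b - rInner r a b) where

    gain-suc : ∀ {a p} → 1 ≤ℕ a → a <ℕ p → p ≤ℕ n → gain a p ≤ gain (suc a) p
    gain-suc {a} {p} 1≤a a<p p≤n = begin
      gain a p                                                      ≡⟨ gain-< a<p ⟩
      r a p - r a (p ∸ 1)                                           ≤⟨ ℤ.+-monoˡ-≤ (- r a (p ∸ 1)) (r-submodular a p 1≤a a<p p≤n) ⟩
      (r a (p ∸ 1) + r (suc a) p - rInner r a p) - r a (p ∸ 1)      ≡⟨ cancel (r a (p ∸ 1)) (r (suc a) p) (rInner r a p) ⟩
      r (suc a) p - rInner r a p                                    ∎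
      where
      open ℤ.≤-Reasoning
      cancel : ∀ y z w → (y + z - w) - y ≡ z - w
      cancel = solve-∀

    gain-mono : ∀ {a b p} → 1 ≤ℕ a → a ≤ℕ b → b ≤ℕ p → p ≤ℕ n → gain a p ≤ gain b p
    gain-mono {a} {b} 1≤a a≤b = go (ℕ.≤⇒≤′ a≤b)
      where
      go : ∀ {b p} → a ≤′ b → b ≤ℕ p → p ≤ℕ n → gain a p ≤ gain b p
      go ≤′-refl b≤p p≤n = ℤ.≤-refl
      go (≤′-step a≤′b) b<p p≤n =
        ℤ.≤-trans (go a≤′b (ℕ.<⇒≤ b<p) p≤n) (gain-suc (ℕ.≤-trans 1≤a (ℕ.≤′⇒≤ a≤′b)) b<p p≤n)

lemma5p17 : (n : ℕ) (r : ℕ → ℕ → ℤ)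
    → (∀ a → 1 ≤ℕ a → a ≤ℕ n → 0ℤ ≤ r a a)
    → (∀ a b → 1 ≤ℕ a → a <ℕ b → b ≤ℕ n → (r a (b ∸ 1) ⊔ r (suc a) b) ≤ r a b)
    → (∀ a b → 1 ≤ℕ a → a <ℕ b → b ≤ℕ n → r a b ≤ r a (b ∸ 1) + r (suc a) b - rInner r a b)
    → (X Y : Subset n) → ρ r (X ∪ Y) + ρ r (X ∩ Y) ≤ ρ r X + ρ r Y
lemma5p17 n r _ _ r-submodular X Y
  rewrite ρ≡gainSum r (X ∪ Y) | ρ≡gainSum r (X ∩ Y) | ρ≡gainSum r X | ρ≡gainSum r Y =
  gainSum-submodular (gain r) n (gain-mono r n r-submodular) 1 (ℕ.≤-reflexive (ℕ.+-comm n 1)) initial X Y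
  where
  initial : StartsCompatible 1 1 1 1 1
  initial = record { 1≤sU = ℕ.≤-refl ; 1≤sI = ℕ.≤-refl ; sX≤p = ℕ.≤-refl ; sY≤p = ℕ.≤-refl
                   ; sU≤sX = ℕ.≤-refl ; sU≤sY = ℕ.≤-refl ; sI≤sX⊎sI≤sY = inj₁ ℕ.≤-refl }
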